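{- Let $\mathcal{T}$ be a common suffix trie. For any node $v$ of $\mathrm{PPH}(\mathcal{T})$, there is at most one node $v'$ of $\mathrm{PPH}(\mathcal{T})$ such that $\mathrm{rslink}(a, v') = v$ for some character $a \in \Sigma \cup \Pi$.
   Context: $\Sigma$ and $\Pi$ are disjoint finite ordered alphabets; $\Sigma \cup \Pi$ carries a fixed total order and strings are compared lexicographically. A p-string is a string over $\Sigma \cup \Pi$; $w^R$ is the reversal of $w$. Two p-strings $x,y$ of equal length $k$ p-match iff some bijection $f$ on $\Sigma\cup\Pi$ fixing every element of $\Sigma$ satisfies $f(x[i]) = y[i]$ for all $i$. $\mathrm{spe}(x)$ is the lexicographically smallest p-string p-matching $x$. A common suffix trie (CS trie) is a rooted tree with edges directed towards the root, labeled by characters of $\Sigma\cup\Pi$, with mutually distinct labels on the in-coming edges of each node; each node represents the concatenation of labels on its path to the root. For a CS trie $\mathcal{T}$ with set $W_{\mathcal{T}}$ of represented p-strings, let $\mathrm{pcs}(\mathcal{T}) = \{\mathrm{spe}(w^R)^R : w \in W_{\mathcal{T}}\} = \{w_1,\ldots,w_{N_p}\}$ enumerated with $|w_i| \le |w_{i+1}|$. The sequence hash tree $\mathrm{SHT}(\langle s_1,\ldots,s_k\rangle)$ is the trie (nodes identified with the strings spelled from the root) built by starting from the root $\varepsilon$ and, for $i = 2, \ldots, k$, adding the node $u_i$ with edge $(v_i, s_i[|v_i|+1], u_i)$, where $v_i$ is the longest prefix of $s_i$ already a node and $u_i$ the shortest prefix of $s_i$ not yet a node. $\mathrm{PPH}(\mathcal{T})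 = \mathrm{SHT}(\langle \mathrm{spe}(w_1),\ldots,\mathrm{spe}(w_{N_p})\rangle)$. For a node $v$ of $\mathrm{PPH}(\mathcal{T})$ (identified with its string) and $a \in \Sigma\cup\Pi$, the reversed suffix link $\mathrm{rslink}(a,v)$ is $\mathrm{spe}(av)$ if $\mathrm{spe}(av)$ is represented (spelled by a root path) in $\mathrm{PPH}(\mathcal{T})$, and is undefined otherwise. -}

module Defs where

open import Data.Nat using (ℕ; _≤_)
open import Data.Bool using (Bool; true; false)
open import Data.Fin using (Fin) renaming (_<_ to _<ᶠ_)
import Data.Fin as Fin
open import Data.List using (List; []; _∷_; _++_; [_]; map; reverse; length; inits; filter; last; drop)
open import Data.List.Properties using (≡-dec)
open import Data.List.Membership.Propositional using (_∈_)
import Data.List.Membership.DecPropositional as DecMem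
open import Data.List.Relation.Unary.Unique.Propositional using (Unique)
open import Data.List.Relation.Unary.Linked using (Linked)
open import Data.Maybe using (Maybe; just; nothing)
open import Data.Product using (Σ; _×_; ∃; ∃-syntax; _,_)
open import Function.Bundles using (_↔_; Inverse)
open import Relation.Binary.PropositionalEquality using (_≡_)
open import Relation.Nullary using (Dec; yes; no)

-- The alphabet Σ ∪ Π with its fixed total order is modelled as Fin n with its
-- natural order; isΠ c ≡ true means c ∈ Π, isΠ c ≡ false means c ∈ Σ.
-- A p-string is a list of characters.
Str : ℕ → Set
Str n = List (Fin n)

data _≤lex_ {n : ℕ} : Str n → Str n → Set where
  lex-[]   : ∀ {y} → [] ≤lex y
  lex-<    : ∀ {c d x y} → c <ᶠ d → (c ∷ x) ≤lex (d ∷ y)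
  lex-≡    : ∀ {c x y} → x ≤lex y → (c ∷ x) ≤lex (c ∷ y)

PMatch : ∀ {n} → (Fin n → Bool) → Str n → Str n → Set
PMatch {n} isΠ x y =
  Σ (Fin n ↔ Fin n) λ f →
    (∀ c → isΠ c ≡ false → Inverse.to f c ≡ c) × (map (Inverse.to f) x ≡ y)

IsSpe : ∀ {n} → (Fin n → Bool) → (Str n → Str n) → Set
IsSpe isΠ spe =
  ∀ x → PMatch isΠ x (spe x) × (∀ y → PMatch isΠ x y → spe x ≤lex y)

-- A common suffix trie, given by the set W of p-strings represented by its
-- nodes (the root represents ε; the parent of the node representing c ∷ w
-- represents w; distinct in-coming labels make nodes ↔ strings injective).
IsCSTrie : ∀ {n} → List (Str n) → Set
IsCSTrie {n} W = ([] ∈ W) × (∀ (c : Fin n) w → (c ∷ w) ∈ W → w ∈ W)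

IsPcsEnum : ∀ {n} → (Str n → Str n) → List (Str n) → List (Str n) → Set
IsPcsEnum spe W ws =
  Unique ws
  × (∀ x → (x ∈ ws → ∃[ w ] (w ∈ W × x ≡ reverse (spe (reverse w))))
         × (∀ w → w ∈ W → reverse (spe (reverse w)) ∈ ws))
  × Linked (λ x y → length x ≤ length y) ws

-- Sequence hash tree; the tree is represented by the list of strings
-- spelled by its nodes.
module _ {n : ℕ} where
  open DecMem {A = Str n} (≡-dec Fin._≟_) using (_∈?_)

  longestNodePrefix : List (Str n) → Str n → Str n
  longestNodePrefix N s with last (filter (_∈? N) (inits s))
  ... | just v  = v
  ... | nothing = []

  shtStep : List (Str n) → Str n → List (Str n)
  shtStep N s with longestNodePrefix N s
  ... | v with drop (length v) s
  ...   | []      = N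
  ...   | (c ∷ _) = (v ++ [ c ]) ∷ N

  shtFold : List (Str n) → List (Str n) → List (Str n)
  shtFold N []       = N
  shtFold N (s ∷ ss) = shtFold (shtStep N s) ss

  SHT : List (Str n) → List (Str n)
  SHT ss = shtFold ([] ∷ []) (drop 1 ss)

PPH : ∀ {n} → (Str n → Str n) → List (Str n) → List (Str n)
PPH spe ws = SHT (map spe ws)

RSLink : ∀ {n} → (Str n → Str n) → List (Str n) → Fin n → Str n → Str n → Set
RSLink spe P a v' v = (spe (a ∷ v') ∈ P) × (spe (a ∷ v') ≡ v)

-- A node of PPH(T) is the root or a prefix of some spe(w), and a prefix of a
-- lexicographically least member of its p-match class is again least in its own
-- class. If spe(a₁v₁) = spe(a₂v₂) = v, then v₁ and v₂ both p-match the tail of v,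
-- hence each other; being both least in that class, they are equal.
module Submission where

open import Defs
open import Data.Nat using (ℕ)
open import Data.Nat.Properties using (suc-injective)
open import Data.Bool using (Bool)
open import Data.Fin using (Fin)
import Data.Fin as Fin
open import Data.Fin.Properties using (<-irrefl; <-asym)
open import Data.List using (List; []; _∷_; _++_; map; length; inits; filter; last; drop)
open import Data.List.Properties using (≡-dec; map-++; map-∘; map-cong; map-id; length-map; drop-map)
open import Data.List.Membership.Propositional using (_∈_)
open import Data.List.Membership.Propositional.Properties using (∈-map⁻)
import Data.List.Membership.DecPropositional as DecMembership
open import Data.List.Relation.Unary.Any using (here; there)
open import Data.List.Relation.Unary.All.Properties using (last⁺; filter⁺)
import Data.List.Relation.Binary.Pointwise as Pointwise
open import Data.List.Relation.Binary.Prefix.Heterogeneous using (Prefix; []; _∷_)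
open import Data.List.Relation.Binary.Prefix.Heterogeneous.Properties using (inits⁺; ++⁺)
open import Data.List.Relation.Binary.Prefix.Propositional.Properties using (Prefix-as-∣ˡ)
open import Algebra.Definitions.RawMagma using (_,_)
open import Data.Maybe using (just; nothing)
open import Data.Maybe.Relation.Unary.All using (just; nothing)
open import Data.Product using (_×_; ∃-syntax; _,_; proj₁; proj₂)
open import Data.Sum using (_⊎_; inj₁; inj₂)
open import Data.Empty using (⊥-elim)
open import Function.Bundles using (Inverse)
open import Function.Properties.Inverse using (↔-trans; ↔-sym)
open import Relation.Binary.PropositionalEquality using (_≡_; refl; sym; trans; cong)

module _ {n : ℕ} where

  ≤lex-antisym : {x y : Str n} → x ≤lex y → y ≤lex x → x ≡ y
  ≤lex-antisym lex-[]    lex-[]    = refl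
  ≤lex-antisym (lex-< p) (lex-< q) = ⊥-elim (<-asym p q)
  ≤lex-antisym (lex-< p) (lex-≡ _) = ⊥-elim (<-irrefl refl p)
  ≤lex-antisym (lex-≡ _) (lex-< q) = ⊥-elim (<-irrefl refl q)
  ≤lex-antisym (lex-≡ p) (lex-≡ q) = cong (_ ∷_) (≤lex-antisym p q)

  ≤lex-++-cancelʳ : (x y t u : Str n) → length x ≡ length y → (x ++ t) ≤lex (y ++ u) → x ≤lex y
  ≤lex-++-cancelʳ []      _       _ _ _  _         = lex-[]
  ≤lex-++-cancelʳ (_ ∷ _) (_ ∷ _) _ _ _  (lex-< p) = lex-< p
  ≤lex-++-cancelʳ (_ ∷ x) (_ ∷ y) t u eq (lex-≡ p) = lex-≡ (≤lex-++-cancelʳ x y t u (suc-injective eq) p)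

module _ {n : ℕ} (isΠ : Fin n → Bool) where

  PMatch-sym : {x y : Str n} → PMatch isΠ x y → PMatch isΠ y x
  PMatch-sym {x} (f , fixΣ , refl) =
    ↔-sym f ,
    (λ c c∈Σ → trans (cong (Inverse.from f) (sym (fixΣ c c∈Σ))) (Inverse.strictlyInverseʳ f c)) ,
    trans (sym (map-∘ x)) (trans (map-cong (Inverse.strictlyInverseʳ f) x) (map-id x))

  PMatch-trans : {x y z : Str n} → PMatch isΠ x y → PMatch isΠ y z → PMatch isΠ x z
  PMatch-trans {x} (f , fixΣ , refl) (g , gixΣ , refl) =
    ↔-trans f g ,
    (λ c c∈Σ → trans (cong (Inverse.to g) (fixΣ c c∈Σ)) (gixΣ c c∈Σ)) ,
    map-∘ x

  PMatch-drop : ∀ k {x y : Str n} → PMatch isΠ x y → PMatch isΠ (drop k x) (drop k y)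
  PMatch-drop k {x} (f , fixΣ , refl) = f , fixΣ , sym (drop-map k x)

  Least : Str n → Set
  Least x = ∀ y → PMatch isΠ x y → x ≤lex y

  spe-least : {spe : Str n → Str n} → IsSpe isΠ spe → ∀ x → Least (spe x)
  spe-least isSpe x y spe-x≈y = proj₂ (isSpe x) y (PMatch-trans (proj₁ (isSpe x)) spe-x≈y)

  Least-prefix : {p s : Str n} → Prefix _≡_ p s → Least s → Least p
  Least-prefix {p} p≼s least with Prefix-as-∣ˡ p≼s
  ... | t , refl = λ where
    _ (f , fixΣ , refl) →
      let g = Inverse.to f in
      ≤lex-++-cancelʳ p (map g p) t (map g t) (sym (length-map g p))
        (least _ (f , fixΣ , map-++ g p t))

  Least-unique : {x y : Str n} → Least x → Least y → PMatch isΠ x y → x ≡ y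
  Least-unique least-x least-y x≈y = ≤lex-antisym (least-x _ x≈y) (least-y _ (PMatch-sym x≈y))

module _ {n : ℕ} where
  open DecMembership {A = Str n} (≡-dec Fin._≟_) using (_∈?_)

  longestNodePrefix-prefix : (N : List (Str n)) (s : Str n) → Prefix _≡_ (longestNodePrefix N s) s
  longestNodePrefix-prefix N s
    with last (filter (_∈? N) (inits s))
       | last⁺ (filter⁺ (_∈? N) (inits⁺ (Pointwise.≡⇒Pointwise-≡ (refl {x = s}))))
  ... | just _  | just v≼s = v≼s
  ... | nothing | nothing  = []

  drop-length-++ : (v t : Str n) → drop (length v) (v ++ t) ≡ t
  drop-length-++ []      t = refl
  drop-length-++ (_ ∷ v) t = drop-length-++ v t

  ∈-shtStep⁻ : ∀ N s {u} → u ∈ shtStep N s → u ∈ N ⊎ Prefix _≡_ u s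
  ∈-shtStep⁻ N s u∈ with longestNodePrefix N s | Prefix-as-∣ˡ (longestNodePrefix-prefix N s)
  ... | v | t , refl with drop (length v) (v ++ t) | drop-length-++ v t
  ...   | []    | _    = inj₁ u∈
  ...   | c ∷ r | refl with u∈
  ...     | here refl = inj₂ (++⁺ (Pointwise.refl refl) (refl ∷ []))
  ...     | there u∈N = inj₁ u∈N

  ∈-shtFold⁻ : ∀ N ss {u} → u ∈ shtFold N ss → u ∈ N ⊎ ∃[ s ] (s ∈ ss × Prefix _≡_ u s)
  ∈-shtFold⁻ N []       u∈ = inj₁ u∈
  ∈-shtFold⁻ N (s ∷ ss) u∈ with ∈-shtFold⁻ (shtStep N s) ss u∈
  ... | inj₂ (s′ , s′∈ , u≼s′) = inj₂ (s′ , there s′∈ , u≼s′)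
  ... | inj₁ u∈step with ∈-shtStep⁻ N s u∈step
  ...   | inj₁ u∈N = inj₁ u∈N
  ...   | inj₂ u≼s = inj₂ (s , here refl , u≼s)

  ∈-SHT⁻ : ∀ ss {u} → u ∈ SHT ss → u ≡ [] ⊎ ∃[ s ] (s ∈ ss × Prefix _≡_ u s)
  ∈-SHT⁻ []       (here u≡[]) = inj₁ u≡[]
  ∈-SHT⁻ (_ ∷ ss) u∈ with ∈-shtFold⁻ ([] ∷ []) ss u∈
  ... | inj₁ (here u≡[])    = inj₁ u≡[]
  ... | inj₂ (s , s∈ , u≼s) = inj₂ (s , there s∈ , u≼s)

  PPH-least : (isΠ : Fin n → Bool) {spe : Str n → Str n} → IsSpe isΠ spe →
              ∀ ws {u} → u ∈ PPH spe ws → Least isΠ u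
  PPH-least isΠ {spe} isSpe ws u∈ with ∈-SHT⁻ (map spe ws) u∈
  ... | inj₁ refl = λ _ _ → lex-[]
  ... | inj₂ (s , s∈ , u≼s) with ∈-map⁻ spe s∈
  ...   | x , _ , refl = Least-prefix isΠ u≼s (spe-least isΠ isSpe x)

lemma8 : ∀ {n : ℕ} (isΠ : Fin n → Bool) (spe : Str n → Str n) → IsSpe isΠ spe →
    (W : List (Str n)) → IsCSTrie W →
    (ws : List (Str n)) → IsPcsEnum spe W ws →
    ∀ (v : Str n) → v ∈ PPH spe ws →
    ∀ (v₁ v₂ : Str n) (a₁ a₂ : Fin n) →
    v₁ ∈ PPH spe ws → v₂ ∈ PPH spe ws →
    RSLink spe (PPH spe ws) a₁ v₁ v → RSLink spe (PPH spe ws) a₂ v₂ v →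
    v₁ ≡ v₂
lemma8 isΠ spe isSpe _ _ ws _ v _ v₁ v₂ a₁ a₂ v₁∈ v₂∈ (_ , spe-a₁v₁≡v) (_ , spe-a₂v₂≡v) =
  Least-unique isΠ (PPH-least isΠ isSpe ws v₁∈) (PPH-least isΠ isSpe ws v₂∈)
    (PMatch-trans isΠ (tail-matches a₁ v₁ spe-a₁v₁≡v) (PMatch-sym isΠ (tail-matches a₂ v₂ spe-a₂v₂≡v)))
  where
  tail-matches : ∀ a w → spe (a ∷ w) ≡ v → PMatch isΠ w (drop 1 v)
  tail-matches a w refl = PMatch-drop isΠ 1 (proj₁ (isSpe (a ∷ w)))
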